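{- Let $\varepsilon\ge 0$, and let $l,r,t\in\mathbb N$ with $l\le r$ and $t\ge1$. Set $i=\left\lceil\frac{1+\varepsilon/2}{1+\varepsilon}l+\frac{\varepsilon/2}{1+\varepsilon}r\right\rceil$ and $j=\left\lfloor\frac{\varepsilon/2}{1+\varepsilon}l+\frac{1+\varepsilon/2}{1+\varepsilon}r\right\rfloor$. Let $a,b$ be two points of a $t$-sparse line metric $U((l,r),t)$ with $i\le a<b\le j$. Then every $(1+\varepsilon)$-spanner path between $a$ and $b$ (i.e. every path through integer points, with edge weights $|x-y|$, of total weight at most $(1+\varepsilon)(b-a)$) has all of its points inside $[l,r]$.
   Context: For integers $l<r$ and $t\ge1$, a $t$-sparse line metric $U((l,r),t)$ is a subset of the integers in $[l,r]$ (with distance $|x-y|$) such that each of the consecutive blocks of $[l,r]$ of $t$ consecutive integers (the $((l,r),t)$-intervals) contains exactly one point of the metric (the representative of that block).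
   Formalization: The parameter ε ranges over the nonnegative rationals. -}

module Defs where

open import Data.Nat as ℕ using (ℕ; _≤_; _*_; _∸_; _/_)
open import Data.Integer as ℤ using (ℤ; +_; ∣_∣)
open import Data.Rational as ℚ using (ℚ; 0ℚ; 1ℚ; ½; _÷_; NonZero; Positive)
open import Data.Rational.Properties using (pos⇒nonZero; pos+nonNeg⇒pos)
open import Data.List using (List; []; _∷_)
open import Data.Product using (∃-syntax; _×_)
open import Relation.Binary.PropositionalEquality using (_≡_)

ℕ→ℚ : ℕ → ℚ
ℕ→ℚ n = ℚ._/_ (+ n) 1

ℤ→ℚ : ℤ → ℚ
ℤ→ℚ z = ℚ._/_ z 1

1+ε-nonZero : (ε : ℚ) → 0ℚ ℚ.≤ ε → NonZero (1ℚ ℚ.+ ε)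
1+ε-nonZero ε h =
  pos⇒nonZero (1ℚ ℚ.+ ε) {{pos+nonNeg⇒pos 1ℚ {{_}} ε {{ℚ.nonNegative h}}}}

iIdx : (ε : ℚ) → 0ℚ ℚ.≤ ε → ℕ → ℕ → ℤ
iIdx ε h l r = ℚ.ceiling
  ((((1ℚ ℚ.+ ε ℚ.* ½) ÷ (1ℚ ℚ.+ ε)) {{1+ε-nonZero ε h}}) ℚ.* ℕ→ℚ l
   ℚ.+ (((ε ℚ.* ½) ÷ (1ℚ ℚ.+ ε)) {{1+ε-nonZero ε h}}) ℚ.* ℕ→ℚ r)

jIdx : (ε : ℚ) → 0ℚ ℚ.≤ ε → ℕ → ℕ → ℤ
jIdx ε h l r = ℚ.floor
  ((((ε ℚ.* ½) ÷ (1ℚ ℚ.+ ε)) {{1+ε-nonZero ε h}}) ℚ.* ℕ→ℚ l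
   ℚ.+ (((1ℚ ℚ.+ ε ℚ.* ½) ÷ (1ℚ ℚ.+ ε)) {{1+ε-nonZero ε h}}) ℚ.* ℕ→ℚ r)

InBlock : ℕ → ℕ → ℕ → ℕ → ℕ → Set
InBlock l r t k x = l ≤ x × x ≤ r × l ℕ.+ k * t ≤ x × x ℕ.< l ℕ.+ (ℕ.suc k) * t

-- The intervals are indexed by k with l + k t ≤ r (the last one may be truncated at r).
IsSparseLineMetric : ℕ → ℕ → ℕ → (ℕ → Set) → Set
IsSparseLineMetric l r t U =
  (∀ x → U x → l ≤ x × x ≤ r)
  × (∀ k → l ℕ.+ k * t ≤ r → ∃[ x ] (U x × InBlock l r t k x))
  × (∀ k x y → U x → U y → InBlock l r t k x → InBlock l r t k y → x ≡ y)

weight : List ℤ → ℕ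
weight [] = 0
weight (x ∷ []) = 0
weight (x ∷ y ∷ zs) = ∣ y ℤ.- x ∣ ℕ.+ weight (y ∷ zs)

{-# OPTIONS --safe #-}
module Submission where

-- A path from a to b through x has weight at least |x − a| + |b − x|, so a
-- (1+ε)-spanner path can reach no further left than (1 + ε/2)a − (ε/2)b and no
-- further right than (1 + ε/2)b − (ε/2)a.  The window [i, j] is chosen so that
-- these reaches are l and r exactly at a = i, b = j, because
-- (1 + ε/2)² − (ε/2)² = 1 + ε.

open import Defs
open import Data.Nat using (ℕ; _≤_; _≥_; _<_; _∸_)
open import Data.Integer as ℤ using (ℤ; +_)
open import Data.Rational as ℚ using (ℚ; 0ℚ; 1ℚ)
open import Data.List using (List; head; last)
open import Data.List.Membership.Propositional using (_∈_)
open import Data.Maybe using (just)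
open import Data.Product using (_×_)
open import Relation.Binary.PropositionalEquality using (_≡_)

import Data.Nat as ℕ
open import Data.Integer using (-[1+_])
import Data.Nat.Properties as ℕP
import Data.Integer.Properties as ℤP
import Data.Integer.DivMod as ℤDM
import Data.Integer.Solver as ℤS
open import Data.Rational using (½; mkℚ; _÷_)
import Data.Rational.Properties as ℚP
import Data.Rational.Unnormalised as ℚᵘ
import Data.Rational.Unnormalised.Properties as ℚᵘP
import Data.Rational.Solver as ℚS
open import Algebra.Properties.Group ℚP.+-0-group using (⁻¹-involutive)
open import Data.List using ([]; _∷_)
open import Data.List.Relation.Unary.Any using (here; there)
open import Data.Maybe.Properties using (just-injective)
open import Data.Product using (_,_; proj₁; proj₂)
open import Relation.Binary.PropositionalEquality
  using (refl; sym; trans; cong; cong₂; subst)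

ℤ→ℚᵘ : ℤ → ℚᵘ.ℚᵘ
ℤ→ℚᵘ z = ℚᵘ.mkℚᵘ z 0

toℚᵘ-ℤ→ℚ : ∀ z → ℚ.toℚᵘ (ℤ→ℚ z) ℚᵘ.≃ ℤ→ℚᵘ z
toℚᵘ-ℤ→ℚ z = ℚP.toℚᵘ-fromℚᵘ (ℤ→ℚᵘ z)

ℤ→ℚ-homo-+ : ∀ x y → ℤ→ℚ (x ℤ.+ y) ≡ ℤ→ℚ x ℚ.+ ℤ→ℚ y
ℤ→ℚ-homo-+ x y = ℚP.toℚᵘ-injective (begin
  ℚ.toℚᵘ (ℤ→ℚ (x ℤ.+ y))                   ≈⟨ toℚᵘ-ℤ→ℚ (x ℤ.+ y) ⟩
  ℤ→ℚᵘ (x ℤ.+ y)                           ≈⟨ ℚᵘ.*≡* ℤ→ℚᵘ-homo-+ ⟩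
  ℤ→ℚᵘ x ℚᵘ.+ ℤ→ℚᵘ y                       ≈⟨ ℚᵘP.+-cong (toℚᵘ-ℤ→ℚ x) (toℚᵘ-ℤ→ℚ y) ⟨
  ℚ.toℚᵘ (ℤ→ℚ x) ℚᵘ.+ ℚ.toℚᵘ (ℤ→ℚ y)       ≈⟨ ℚP.toℚᵘ-homo-+ (ℤ→ℚ x) (ℤ→ℚ y) ⟨
  ℚ.toℚᵘ (ℤ→ℚ x ℚ.+ ℤ→ℚ y)                 ∎)
  where
  open ℚᵘP.≃-Reasoning
  ℤ→ℚᵘ-homo-+ : (x ℤ.+ y) ℤ.* + 1 ≡ (x ℤ.* + 1 ℤ.+ y ℤ.* + 1) ℤ.* + 1
  ℤ→ℚᵘ-homo-+ rewrite ℤP.*-identityʳ x | ℤP.*-identityʳ y | ℤP.*-identityʳ (x ℤ.+ y) = refl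

ℤ→ℚ-homo‿- : ∀ x → ℤ→ℚ (ℤ.- x) ≡ ℚ.- ℤ→ℚ x
ℤ→ℚ-homo‿- x = ℚP.toℚᵘ-injective (begin
  ℚ.toℚᵘ (ℤ→ℚ (ℤ.- x))     ≈⟨ toℚᵘ-ℤ→ℚ (ℤ.- x) ⟩
  ℚᵘ.- ℤ→ℚᵘ x              ≈⟨ ℚᵘP.-‿cong (toℚᵘ-ℤ→ℚ x) ⟨
  ℚᵘ.- ℚ.toℚᵘ (ℤ→ℚ x)      ≈⟨ ℚP.toℚᵘ-homo‿- (ℤ→ℚ x) ⟨
  ℚ.toℚᵘ (ℚ.- ℤ→ℚ x)       ∎)
  where open ℚᵘP.≃-Reasoning

ℤ→ℚ-homo-− : ∀ x y → ℤ→ℚ (x ℤ.- y) ≡ ℤ→ℚ x ℚ.- ℤ→ℚ y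
ℤ→ℚ-homo-− x y = trans (ℤ→ℚ-homo-+ x (ℤ.- y)) (cong (ℤ→ℚ x ℚ.+_) (ℤ→ℚ-homo‿- y))

ℤ→ℚ-mono-≤ : ∀ {x y} → x ℤ.≤ y → ℤ→ℚ x ℚ.≤ ℤ→ℚ y
ℤ→ℚ-mono-≤ {x} {y} x≤y = ℚP.toℚᵘ-cancel-≤
  (ℚᵘP.≤-respˡ-≃ (ℚᵘP.≃-sym (toℚᵘ-ℤ→ℚ x)) (ℚᵘP.≤-respʳ-≃ (ℚᵘP.≃-sym (toℚᵘ-ℤ→ℚ y))
    (ℚᵘ.*≤* (ℤP.*-monoʳ-≤-nonNeg (+ 1) x≤y))))

ℤ→ℚ-cancel-≤ : ∀ {x y} → ℤ→ℚ x ℚ.≤ ℤ→ℚ y → x ℤ.≤ y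
ℤ→ℚ-cancel-≤ {x} {y} x≤y
  with ℚᵘP.≤-respˡ-≃ (toℚᵘ-ℤ→ℚ x) (ℚᵘP.≤-respʳ-≃ (toℚᵘ-ℤ→ℚ y) (ℚP.toℚᵘ-mono-≤ x≤y))
... | ℚᵘ.*≤* x*1≤y*1 = ℤP.*-cancelʳ-≤-pos x y (+ 1) x*1≤y*1

ℕ→ℚ-homo-∸ : ∀ {m n} → n ≤ m → ℕ→ℚ (m ∸ n) ≡ ℕ→ℚ m ℚ.- ℕ→ℚ n
ℕ→ℚ-homo-∸ {m} {n} n≤m =
  trans (cong ℤ→ℚ (sym (trans (ℤP.m-n≡m⊖n m n) (ℤP.⊖-≥ n≤m)))) (ℤ→ℚ-homo-− (+ m) (+ n))

ℤ→ℚ[⌊p⌋]≤p : ∀ p → ℤ→ℚ (ℚ.floor p) ℚ.≤ p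
ℤ→ℚ[⌊p⌋]≤p p@(mkℚ n d-1 _) = ℚP.toℚᵘ-cancel-≤ (ℚᵘP.≤-respˡ-≃ (ℚᵘP.≃-sym (toℚᵘ-ℤ→ℚ (ℚ.floor p)))
  (ℚᵘ.*≤* (subst (ℚ.floor p ℤ.* ℚ.↧ p ℤ.≤_) (sym (ℤP.*-identityʳ n)) (ℤDM.[n/d]*d≤n n (ℚ.↧ p)))))

p≤ℤ→ℚ[⌈p⌉] : ∀ p → p ℚ.≤ ℤ→ℚ (ℚ.ceiling p)
p≤ℤ→ℚ[⌈p⌉] p@(mkℚ _ _ _) = begin
  p                                   ≡⟨ ⁻¹-involutive p ⟨
  ℚ.- (ℚ.- p)                         ≤⟨ ℚP.neg-antimono-≤ (ℤ→ℚ[⌊p⌋]≤p (ℚ.- p)) ⟩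
  ℚ.- ℤ→ℚ (ℚ.floor (ℚ.- p))           ≡⟨ ℤ→ℚ-homo‿- (ℚ.floor (ℚ.- p)) ⟨
  ℤ→ℚ (ℚ.ceiling p)                   ∎
  where open ℚP.≤-Reasoning

∣k-i∣≤∣j-i∣+∣k-j∣ : ∀ i j k → ℤ.∣ k ℤ.- i ∣ ℕ.≤ ℤ.∣ j ℤ.- i ∣ ℕ.+ ℤ.∣ k ℤ.- j ∣
∣k-i∣≤∣j-i∣+∣k-j∣ i j k =
  subst (λ z → ℤ.∣ z ∣ ℕ.≤ ℤ.∣ j ℤ.- i ∣ ℕ.+ ℤ.∣ k ℤ.- j ∣) split (ℤP.∣i+j∣≤∣i∣+∣j∣ (j ℤ.- i) (k ℤ.- j))
  where
  open ℤS.+-*-Solver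
  split : (j ℤ.- i) ℤ.+ (k ℤ.- j) ≡ k ℤ.- i
  split = solve 3 (λ i j k → (j :- i) :+ (k :- j) := k :- i) refl i j k

∣i-i∣≡0 : ∀ i → ℤ.∣ i ℤ.- i ∣ ≡ 0
∣i-i∣≡0 i = cong ℤ.∣_∣ (ℤP.+-inverseʳ i)

end-to-end≤weight : ∀ h rest {b} → last (h ∷ rest) ≡ just b → ℤ.∣ b ℤ.- h ∣ ℕ.≤ weight (h ∷ rest)
end-to-end≤weight h [] refl = ℕP.≤-reflexive (∣i-i∣≡0 h)
end-to-end≤weight h (y ∷ zs) {b} last≡b = begin
  ℤ.∣ b ℤ.- h ∣                          ≤⟨ ∣k-i∣≤∣j-i∣+∣k-j∣ h y b ⟩
  ℤ.∣ y ℤ.- h ∣ ℕ.+ ℤ.∣ b ℤ.- y ∣        ≤⟨ ℕP.+-monoʳ-≤ ℤ.∣ y ℤ.- h ∣ (end-to-end≤weight y zs last≡b) ⟩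
  ℤ.∣ y ℤ.- h ∣ ℕ.+ weight (y ∷ zs)      ∎
  where open ℕP.≤-Reasoning

detour≤weight : ∀ h rest {b x} → last (h ∷ rest) ≡ just b → x ∈ h ∷ rest →
  ℤ.∣ x ℤ.- h ∣ ℕ.+ ℤ.∣ b ℤ.- x ∣ ℕ.≤ weight (h ∷ rest)
detour≤weight h rest last≡b (here refl) rewrite ∣i-i∣≡0 h = end-to-end≤weight h rest last≡b
detour≤weight h (y ∷ zs) {b} {x} last≡b (there x∈) = begin
  ℤ.∣ x ℤ.- h ∣ ℕ.+ ℤ.∣ b ℤ.- x ∣                        ≤⟨ ℕP.+-monoˡ-≤ ℤ.∣ b ℤ.- x ∣ (∣k-i∣≤∣j-i∣+∣k-j∣ h y x) ⟩
  (ℤ.∣ y ℤ.- h ∣ ℕ.+ ℤ.∣ x ℤ.- y ∣) ℕ.+ ℤ.∣ b ℤ.- x ∣    ≡⟨ ℕP.+-assoc ℤ.∣ y ℤ.- h ∣ _ _ ⟩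
  ℤ.∣ y ℤ.- h ∣ ℕ.+ (ℤ.∣ x ℤ.- y ∣ ℕ.+ ℤ.∣ b ℤ.- x ∣)    ≤⟨ ℕP.+-monoʳ-≤ ℤ.∣ y ℤ.- h ∣ (detour≤weight y zs last≡b x∈) ⟩
  ℤ.∣ y ℤ.- h ∣ ℕ.+ weight (y ∷ zs)                      ∎
  where open ℕP.≤-Reasoning

i≤+∣i∣ : ∀ i → i ℤ.≤ + ℤ.∣ i ∣
i≤+∣i∣ (+ n)    = ℤP.≤-refl
i≤+∣i∣ -[1+ n ] = ℤ.-≤+

i-j≤+∣j-i∣ : ∀ i j → i ℤ.- j ℤ.≤ + ℤ.∣ j ℤ.- i ∣
i-j≤+∣j-i∣ i j = subst (λ n → i ℤ.- j ℤ.≤ + n) (ℤP.∣i-j∣≡∣j-i∣ i j) (i≤+∣i∣ (i ℤ.- j))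

signed-detours≤ : ∀ a b x {w} → ℤ.∣ x ℤ.- a ∣ ℕ.+ ℤ.∣ b ℤ.- x ∣ ℕ.≤ w →
  (ℤ→ℚ a ℚ.- ℤ→ℚ x) ℚ.+ (ℤ→ℚ b ℚ.- ℤ→ℚ x) ℚ.≤ ℕ→ℚ w ×
  (ℤ→ℚ x ℚ.- ℤ→ℚ a) ℚ.+ (ℤ→ℚ x ℚ.- ℤ→ℚ b) ℚ.≤ ℕ→ℚ w
signed-detours≤ a b x detour≤w =
  embed a x b x (ℤP.≤-trans (ℤP.+-mono-≤ (i-j≤+∣j-i∣ a x) (i≤+∣i∣ (b ℤ.- x))) (ℤ.+≤+ detour≤w)) ,
  embed x a x b (ℤP.≤-trans (ℤP.+-mono-≤ (i≤+∣i∣ (x ℤ.- a)) (i-j≤+∣j-i∣ x b)) (ℤ.+≤+ detour≤w))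
  where
  embed : ∀ i j k m {w} → (i ℤ.- j) ℤ.+ (k ℤ.- m) ℤ.≤ + w →
    (ℤ→ℚ i ℚ.- ℤ→ℚ j) ℚ.+ (ℤ→ℚ k ℚ.- ℤ→ℚ m) ℚ.≤ ℕ→ℚ w
  embed i j k m {w} ≤w = subst (ℚ._≤ ℕ→ℚ w)
    (trans (ℤ→ℚ-homo-+ (i ℤ.- j) (k ℤ.- m)) (cong₂ ℚ._+_ (ℤ→ℚ-homo-− i j) (ℤ→ℚ-homo-− k m)))
    (ℤ→ℚ-mono-≤ ≤w)

module _ (ε : ℚ) where
  open ℚP.≤-Reasoning
  open ℚS.+-*-Solver

  leftmost-reach rightmost-reach : ℚ → ℚ → ℚ
  leftmost-reach  A B = (1ℚ ℚ.+ ε ℚ.* ½) ℚ.* A ℚ.- ε ℚ.* ½ ℚ.* B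
  rightmost-reach A B = (1ℚ ℚ.+ ε ℚ.* ½) ℚ.* B ℚ.- ε ℚ.* ½ ℚ.* A

  leftmost-reach≤ : ∀ A B X → (A ℚ.- X) ℚ.+ (B ℚ.- X) ℚ.≤ (1ℚ ℚ.+ ε) ℚ.* (B ℚ.- A) →
    leftmost-reach A B ℚ.≤ X
  leftmost-reach≤ A B X detour≤ = begin
    leftmost-reach A B
      ≡⟨ solve 3 (λ e a b → (con 1ℚ :+ e :* con ½) :* a :- e :* con ½ :* b
                           := con ½ :* ((a :+ b) :- (con 1ℚ :+ e) :* (b :- a))) refl ε A B ⟩
    ½ ℚ.* ((A ℚ.+ B) ℚ.- (1ℚ ℚ.+ ε) ℚ.* (B ℚ.- A))
      ≤⟨ ℚP.*-monoˡ-≤-nonNeg ½ (ℚP.+-monoʳ-≤ (A ℚ.+ B) (ℚP.neg-antimono-≤ detour≤)) ⟩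
    ½ ℚ.* ((A ℚ.+ B) ℚ.- ((A ℚ.- X) ℚ.+ (B ℚ.- X)))
      ≡⟨ solve 3 (λ a b x → con ½ :* ((a :+ b) :- ((a :- x) :+ (b :- x))) := x) refl A B X ⟩
    X ∎

  ≤rightmost-reach : ∀ A B X → (X ℚ.- A) ℚ.+ (X ℚ.- B) ℚ.≤ (1ℚ ℚ.+ ε) ℚ.* (B ℚ.- A) →
    X ℚ.≤ rightmost-reach A B
  ≤rightmost-reach A B X detour≤ = begin
    X
      ≡⟨ solve 3 (λ a b x → x := con ½ :* (((x :- a) :+ (x :- b)) :+ (a :+ b))) refl A B X ⟩
    ½ ℚ.* (((X ℚ.- A) ℚ.+ (X ℚ.- B)) ℚ.+ (A ℚ.+ B))
      ≤⟨ ℚP.*-monoˡ-≤-nonNeg ½ (ℚP.+-monoˡ-≤ (A ℚ.+ B) detour≤) ⟩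
    ½ ℚ.* ((1ℚ ℚ.+ ε) ℚ.* (B ℚ.- A) ℚ.+ (A ℚ.+ B))
      ≡⟨ solve 3 (λ e a b → con ½ :* ((con 1ℚ :+ e) :* (b :- a) :+ (a :+ b))
                           := (con 1ℚ :+ e :* con ½) :* b :- e :* con ½ :* a) refl ε A B ⟩
    rightmost-reach A B ∎

module Window (ε : ℚ) (ε≥0 : 0ℚ ℚ.≤ ε) (L R : ℚ) where
  open ℚP.≤-Reasoning
  open ℚS.+-*-Solver

  instance
    1+ε≢0 : ℚ.NonZero (1ℚ ℚ.+ ε)
    1+ε≢0 = 1+ε-nonZero ε ε≥0
    ε/2≥0 : ℚ.NonNegative (ε ℚ.* ½)
    ε/2≥0 = ℚP.nonNeg*nonNeg⇒nonNeg ε {{ℚ.nonNegative ε≥0}} ½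
    1+ε/2≥0 : ℚ.NonNegative (1ℚ ℚ.+ ε ℚ.* ½)
    1+ε/2≥0 = ℚP.nonNeg+nonNeg⇒nonNeg 1ℚ (ε ℚ.* ½)

  α β : ℚ
  α = (1ℚ ℚ.+ ε ℚ.* ½) ÷ (1ℚ ℚ.+ ε)
  β = (ε ℚ.* ½) ÷ (1ℚ ℚ.+ ε)

  left-end right-end : ℚ
  left-end  = α ℚ.* L ℚ.+ β ℚ.* R
  right-end = β ℚ.* L ℚ.+ α ℚ.* R

  [1+ε]*1/[1+ε]*P≡P : ∀ P → ((1ℚ ℚ.+ ε) ℚ.* ℚ.1/ (1ℚ ℚ.+ ε)) ℚ.* P ≡ P
  [1+ε]*1/[1+ε]*P≡P P = trans (cong (ℚ._* P) (ℚP.*-inverseʳ (1ℚ ℚ.+ ε))) (ℚP.*-identityˡ P)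

  left-end-recovers-L : (1ℚ ℚ.+ ε ℚ.* ½) ℚ.* left-end ℚ.- ε ℚ.* ½ ℚ.* right-end ≡ L
  left-end-recovers-L = trans
    (solve 4 (λ e z l r →
       (con 1ℚ :+ e :* con ½) :* ((con 1ℚ :+ e :* con ½) :* z :* l :+ e :* con ½ :* z :* r)
         :- e :* con ½ :* (e :* con ½ :* z :* l :+ (con 1ℚ :+ e :* con ½) :* z :* r)
       := ((con 1ℚ :+ e) :* z) :* l) refl ε (ℚ.1/ (1ℚ ℚ.+ ε)) L R)
    ([1+ε]*1/[1+ε]*P≡P L)

  right-end-recovers-R : (1ℚ ℚ.+ ε ℚ.* ½) ℚ.* right-end ℚ.- ε ℚ.* ½ ℚ.* left-end ≡ R
  right-end-recovers-R = trans
    (solve 4 (λ e z l r →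
       (con 1ℚ :+ e :* con ½) :* (e :* con ½ :* z :* l :+ (con 1ℚ :+ e :* con ½) :* z :* r)
         :- e :* con ½ :* ((con 1ℚ :+ e :* con ½) :* z :* l :+ e :* con ½ :* z :* r)
       := ((con 1ℚ :+ e) :* z) :* r) refl ε (ℚ.1/ (1ℚ ℚ.+ ε)) L R)
    ([1+ε]*1/[1+ε]*P≡P R)

  L≤leftmost-reach : ∀ {A B} → left-end ℚ.≤ A → B ℚ.≤ right-end → L ℚ.≤ leftmost-reach ε A B
  L≤leftmost-reach {A} {B} left-end≤A B≤right-end = begin
    L                                                                   ≡⟨ left-end-recovers-L ⟨
    (1ℚ ℚ.+ ε ℚ.* ½) ℚ.* left-end ℚ.- ε ℚ.* ½ ℚ.* right-end
      ≤⟨ ℚP.+-mono-≤ (ℚP.*-monoˡ-≤-nonNeg (1ℚ ℚ.+ ε ℚ.* ½) left-end≤A)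
                     (ℚP.neg-antimono-≤ (ℚP.*-monoˡ-≤-nonNeg (ε ℚ.* ½) B≤right-end)) ⟩
    leftmost-reach ε A B                                                ∎

  rightmost-reach≤R : ∀ {A B} → left-end ℚ.≤ A → B ℚ.≤ right-end → rightmost-reach ε A B ℚ.≤ R
  rightmost-reach≤R {A} {B} left-end≤A B≤right-end = begin
    rightmost-reach ε A B
      ≤⟨ ℚP.+-mono-≤ (ℚP.*-monoˡ-≤-nonNeg (1ℚ ℚ.+ ε ℚ.* ½) B≤right-end)
                     (ℚP.neg-antimono-≤ (ℚP.*-monoˡ-≤-nonNeg (ε ℚ.* ½) left-end≤A)) ⟩
    (1ℚ ℚ.+ ε ℚ.* ½) ℚ.* right-end ℚ.- ε ℚ.* ½ ℚ.* left-end             ≡⟨ right-end-recovers-R ⟩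
    R                                                                   ∎

lemma1 : (ε : ℚ) (hε : 0ℚ ℚ.≤ ε) (l r t : ℕ) → l ≤ r → t ≥ 1 →
    (U : ℕ → Set) → IsSparseLineMetric l r t U →
    (a b : ℕ) → U a → U b →
    iIdx ε hε l r ℤ.≤ + a → a Data.Nat.< b → + b ℤ.≤ jIdx ε hε l r →
    (p : List ℤ) → head p ≡ just (+ a) → last p ≡ just (+ b) →
    ℕ→ℚ (weight p) ℚ.≤ (1ℚ ℚ.+ ε) ℚ.* ℕ→ℚ (b ∸ a) →
    ∀ x → x ∈ p → (+ l ℤ.≤ x × x ℤ.≤ + r)
lemma1 ε hε l r t _ _ U _ a b _ _ i≤a a<b b≤j (h ∷ rest) head≡a last≡b spanner x x∈p
  with refl ← just-injective head≡a =
  ℤ→ℚ-cancel-≤ (ℚP.≤-trans (L≤leftmost-reach left-end≤A B≤right-end)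
                            (leftmost-reach≤ ε A B X (within-spanner (proj₁ detours)))) ,
  ℤ→ℚ-cancel-≤ (ℚP.≤-trans (≤rightmost-reach ε A B X (within-spanner (proj₂ detours)))
                            (rightmost-reach≤R left-end≤A B≤right-end))
  where
  open Window ε hε (ℕ→ℚ l) (ℕ→ℚ r)
  A B X W : ℚ
  A = ℕ→ℚ a
  B = ℕ→ℚ b
  X = ℤ→ℚ x
  W = ℕ→ℚ (weight (+ a ∷ rest))
  left-end≤A : left-end ℚ.≤ A
  left-end≤A = ℚP.≤-trans (p≤ℤ→ℚ[⌈p⌉] left-end) (ℤ→ℚ-mono-≤ i≤a)
  B≤right-end : B ℚ.≤ right-end
  B≤right-end = ℚP.≤-trans (ℤ→ℚ-mono-≤ b≤j) (ℤ→ℚ[⌊p⌋]≤p right-end)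
  detours : (A ℚ.- X) ℚ.+ (B ℚ.- X) ℚ.≤ W × (X ℚ.- A) ℚ.+ (X ℚ.- B) ℚ.≤ W
  detours = signed-detours≤ (+ a) (+ b) x (detour≤weight (+ a) rest last≡b x∈p)
  within-spanner : ∀ {P} → P ℚ.≤ W → P ℚ.≤ (1ℚ ℚ.+ ε) ℚ.* (B ℚ.- A)
  within-spanner P≤W = ℚP.≤-trans P≤W (subst (λ d → W ℚ.≤ (1ℚ ℚ.+ ε) ℚ.* d) (ℕ→ℚ-homo-∸ (ℕP.<⇒≤ a<b)) spanner)
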